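{- For every integer $t\ge 3$ there exists $N$ such that for all integers $n\ge N$ and $k\ge 1$ with $n-2k+2=t$, the Kneser graph $\mathrm{KG}(n,k)$ contains an odd $K_t$ minor.
   Context: For $n>2k$, the Kneser graph $\mathrm{KG}(n,k)$ has as vertices all $k$-element subsets of $\{1,\dots,n\}$, two being adjacent iff they are disjoint (its chromatic number is $n-2k+2$). An odd $K_m$ minor of a graph $G$ consists of $m$ pairwise vertex-disjoint trees $T_1,\dots,T_m$ that are subgraphs of $G$, together with a $2$-coloring of the vertices of $T_1\cup\dots\cup T_m$ such that (1) each $T_i$ is properly colored, and (2) for every pair $i\neq j$ there is an edge of $G$ between a vertex of $T_i$ and a vertex of $T_j$ having the same color. -}

module Defs where

open import Data.Nat using (ℕ; _<_)
open import Data.Fin using (Fin)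
open import Data.Fin.Subset using (Subset; _∩_; ∣_∣; Empty)
open import Data.Bool using (Bool)
open import Data.Product using (Σ; ∃; _×_)
open import Relation.Binary.PropositionalEquality using (_≡_)
open import Relation.Nullary using (¬_)

record Graph : Set₁ where
  field
    Vertex : Set
    Adj    : Vertex → Vertex → Set

KG : ℕ → ℕ → Graph
KG n k = record
  { Vertex = Σ (Subset n) (λ s → ∣ s ∣ ≡ k)
  ; Adj    = λ A B → Empty (Σ.proj₁ A ∩ Σ.proj₁ B)
  }

-- An odd K_m minor of G: m pairwise vertex-disjoint trees T_1..T_m that are
-- subgraphs of G, and a 2-colouring of their vertices such that each tree is
-- properly coloured and between any two distinct trees there is an edge of G
-- joining equally coloured vertices.
--
-- Each tree T_i is encoded as a rooted tree: its vertex set (predicate inT i),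
-- a root, and for each non-root vertex v a parent (a vertex of T_i adjacent
-- to v in G). A depth function strictly decreasing along parent steps
-- guarantees that following parents always reaches the root, so the edges
-- {v, parent v} form exactly a tree spanning the vertex set of T_i.
-- Every subtree of G admits such an encoding (root it anywhere).
record OddMinor (G : Graph) (m : ℕ) : Set₁ where
  open Graph G
  field
    inT      : Fin m → Vertex → Set
    disjoint : ∀ {i j v} → inT i v → inT j v → i ≡ j
    root     : Fin m → Vertex
    root∈    : ∀ i → inT i (root i)
    parent   : ∀ i v → inT i v → ¬ (v ≡ root i) → Vertex
    parent∈  : ∀ i v (p : inT i v) (nr : ¬ (v ≡ root i)) → inT i (parent i v p nr)
    parentAdj : ∀ i v (p : inT i v) (nr : ¬ (v ≡ root i)) → Adj v (parent i v p nr)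
    depth    : Vertex → ℕ
    depthDec : ∀ i v (p : inT i v) (nr : ¬ (v ≡ root i)) →
               depth (parent i v p nr) < depth v
    colour   : Vertex → Bool
    proper   : ∀ i v (p : inT i v) (nr : ¬ (v ≡ root i)) →
               ¬ (colour (parent i v p nr) ≡ colour v)
    oddEdge  : ∀ i j → ¬ (i ≡ j) →
               ∃ λ u → ∃ λ w → inT i u × inT j w × Adj u w × (colour u ≡ colour w)

module Submission where

-- Write t = s + 2 with s ≥ 1.  The hypotheses force k > s and n = 2k + s, and for all such
-- parameters we exhibit an explicit odd K_(s+2) minor of KG(2k+s, k) on the ground set [0, n).
-- It uses four families of k-sets: intervals I a = [a, a+k), co-intervals J a (the complement of
-- [a, a+k+s)), hooks H c = [c+1, k+c) ∪ {2k+c} and bridges B c (the complement of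
-- [1, k+s) ∪ {2k+c}).  The s + 2 trees are {I 0}, {I (k+s)} and, for each offset 1 ≤ p ≤ s,
-- the path  I p – J p – I (p+s) – J (p+s) – … – I b – H (b-k) – B (b-k)  with k ≤ b < k+s.
-- Intervals and bridges are coloured true, co-intervals and hooks false; the equally coloured
-- edges are I 0 ~ I (k+s), I 0 ~ I b, I (k+s) ~ I p and B of one thread ~ I p' of any other.
-- Threads are disjoint because the positions along the thread of p are ≡ p (mod s).

open import Defs
open import Function using (_∘_)
open import Data.Nat using (ℕ; zero; suc; _+_; _*_; _∸_; _⊓_; _≤_; _<_; _≥_; z≤n; s≤s; NonZero)
open import Data.Nat.Properties
open import Data.Nat.DivMod using (_%_; [m+kn]%n≡m%n; m<n⇒m%n≡m)
open import Data.Nat.Tactic.RingSolver using (solve-∀)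
open import Data.Bool using (Bool; true; false; _∧_; _∨_; not; if_then_else_)
open import Data.Bool.Properties using (∧-comm; ∧-zeroʳ; ∨-zeroʳ; not-injective)
open import Data.Fin using (Fin; zero; suc; toℕ)
open import Data.Fin.Properties using (toℕ<n; toℕ-injective)
open import Data.Fin.Subset using (Subset; _∩_; ∣_∣; Empty)
open import Data.Fin.Subset.Properties using (∩-comm)
open import Data.Vec using ([]; _∷_; tabulate)
open import Data.Vec.Properties using (lookup∘tabulate; lookup-zipWith; []=⇒lookup)
open import Data.Product using (∃; _×_; _,_; proj₁)
open import Data.Sum using (_⊎_; inj₁; inj₂)
open import Data.Empty using (⊥; ⊥-elim)
open import Relation.Nullary using (yes; no; does)
open import Relation.Nullary.Decidable using (dec-true; dec-false)
open import Relation.Binary.PropositionalEquality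
  using (_≡_; _≢_; refl; sym; trans; cong; cong₂; subst; subst₂; module ≡-Reasoning)

indicator : Bool → ℕ
indicator true  = 1
indicator false = 0

count : (ℕ → Bool) → ℕ → ℕ
count f zero    = 0
count f (suc m) = indicator (f 0) + count (f ∘ suc) m

count-ext : ∀ m (f g : ℕ → Bool) → (∀ x → x < m → f x ≡ g x) → count f m ≡ count g m
count-ext zero    f g f≗g = refl
count-ext (suc m) f g f≗g =
  cong₂ _+_ (cong indicator (f≗g 0 (s≤s z≤n)))
            (count-ext m (f ∘ suc) (g ∘ suc) (λ x x<m → f≗g (suc x) (s≤s x<m)))

count-∨ : ∀ m (f g : ℕ → Bool) → (∀ x → f x ∧ g x ≡ false) →
          count (λ x → f x ∨ g x) m ≡ count f m + count g m
count-∨ zero    f g disj = refl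
count-∨ (suc m) f g disj with f 0 | g 0 | disj 0 | count-∨ m (f ∘ suc) (g ∘ suc) (disj ∘ suc)
... | true  | false | _ | ih = cong suc ih
... | false | true  | _ | ih = trans (cong suc ih) (sym (+-suc _ _))
... | false | false | _ | ih = ih

count-complement : ∀ m (f : ℕ → Bool) → count f m + count (not ∘ f) m ≡ m
count-complement zero    f = refl
count-complement (suc m) f with f 0 | count-complement m (f ∘ suc)
... | true  | ih = cong suc ih
... | false | ih = trans (+-suc _ _) (cong suc ih)

count-not : ∀ m (f : ℕ → Bool) {c} → count f m ≡ c → count (not ∘ f) m ≡ m ∸ c
count-not m f {c} refl = sym (trans (cong (_∸ c) (sym (count-complement m f))) (m+n∸m≡n c _))

subsetOf : ∀ {m} → (ℕ → Bool) → Subset m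
subsetOf f = tabulate (f ∘ toℕ)

∣subsetOf∣ : ∀ m (f : ℕ → Bool) → ∣ subsetOf {m} f ∣ ≡ count f m
∣subsetOf∣ zero    f = refl
∣subsetOf∣ (suc m) f with f 0
... | true  = cong suc (∣subsetOf∣ m (f ∘ suc))
... | false = ∣subsetOf∣ m (f ∘ suc)

member : ∀ {m} → Subset m → ℕ → Bool
member []      x       = false
member (b ∷ p) zero    = b
member (b ∷ p) (suc x) = member p x

member-subsetOf : ∀ {m} (f : ℕ → Bool) x → x < m → member (subsetOf {m} f) x ≡ f x
member-subsetOf {suc m} f zero    x<m       = refl
member-subsetOf {suc m} f (suc x) (s≤s x<m) = member-subsetOf {m} (f ∘ suc) x x<m

subsetOf-disjoint : ∀ {m} (f g : ℕ → Bool) → (∀ x → f x ∧ g x ≡ false) →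
                    Empty (subsetOf {m} f ∩ subsetOf {m} g)
subsetOf-disjoint {m} f g disj (i , i∈) with []=⇒lookup i∈
... | i∈f∩g rewrite lookup-zipWith _∧_ i (subsetOf {m} f) (subsetOf {m} g)
                  | lookup∘tabulate (f ∘ toℕ) i | lookup∘tabulate (g ∘ toℕ) i
                  | disj (toℕ i) = false≢true i∈f∩g
  where
  false≢true : false ≡ true → ⊥
  false≢true ()

Empty-∩-sym : ∀ {m} (p q : Subset m) → Empty (p ∩ q) → Empty (q ∩ p)
Empty-∩-sym p q = subst Empty (∩-comm p q)

∨-∧-false : ∀ a b {c} → a ∧ c ≡ false → b ∧ c ≡ false → (a ∨ b) ∧ c ≡ false
∨-∧-false true  _ ac _  = ac
∨-∧-false false _ _  bc = bc

∨-⊆ : ∀ {a b a' b'} → (a ≡ true → a' ≡ true) → (b ≡ true → b' ≡ true) →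
      a ∨ b ≡ true → a' ∨ b' ≡ true
∨-⊆ {true}          a⊆a' b⊆b' _   rewrite a⊆a' refl = refl
∨-⊆ {false} {a' = a'} a⊆a' b⊆b' b∈ rewrite b⊆b' b∈ = ∨-zeroʳ a'

∨-true-right : ∀ {a b} → a ≡ false → a ∨ b ≡ true → b ≡ true
∨-true-right refl b≡true = b≡true

⊆-∧-not : ∀ {a b} → (a ≡ true → b ≡ true) → a ∧ not b ≡ false
⊆-∧-not {false}         a⊆b = refl
⊆-∧-not {true} {true}  a⊆b = refl
⊆-∧-not {true} {false} a⊆b with a⊆b refl
... | ()

interval : ℕ → ℕ → ℕ → Bool
interval zero    zero    x       = false
interval zero    (suc h) zero    = true
interval zero    (suc h) (suc x) = interval zero h x
interval (suc l) h       zero    = false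
interval (suc l) zero    (suc x) = false
interval (suc l) (suc h) (suc x) = interval l h x

interval-∋ : ∀ l h x → l ≤ x → x < h → interval l h x ≡ true
interval-∋ zero    (suc h) zero    z≤n     x<h       = refl
interval-∋ zero    (suc h) (suc x) z≤n     (s≤s x<h) = interval-∋ zero h x z≤n x<h
interval-∋ (suc l) (suc h) (suc x) (s≤s l≤x) (s≤s x<h) = interval-∋ l h x l≤x x<h

interval-sound : ∀ l h x → interval l h x ≡ true → l ≤ x × x < h
interval-sound zero    (suc h) zero    refl = z≤n , s≤s z≤n
interval-sound zero    (suc h) (suc x) x∈   with interval-sound zero h x x∈
... | _ , x<h = z≤n , s≤s x<h
interval-sound (suc l) (suc h) (suc x) x∈   with interval-sound l h x x∈
... | l≤x , x<h = s≤s l≤x , s≤s x<h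

interval-below : ∀ l h x → x < l → interval l h x ≡ false
interval-below (suc l) h       zero    _         = refl
interval-below (suc l) zero    (suc x) _         = refl
interval-below (suc l) (suc h) (suc x) (s≤s x<l) = interval-below l h x x<l

interval-above : ∀ l h x → h ≤ x → interval l h x ≡ false
interval-above zero    zero    x       _         = refl
interval-above zero    (suc h) (suc x) (s≤s h≤x) = interval-above zero h x h≤x
interval-above (suc l) zero    zero    _         = refl
interval-above (suc l) zero    (suc x) _         = refl
interval-above (suc l) (suc h) (suc x) (s≤s h≤x) = interval-above l h x h≤x

interval-⊆ : ∀ {l h l' h'} → l' ≤ l → h ≤ h' → ∀ x → interval l h x ≡ true → interval l' h' x ≡ true
interval-⊆ {l} {h} {l'} {h'} l'≤l h≤h' x x∈ with interval-sound l h x x∈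
... | l≤x , x<h = interval-∋ l' h' x (≤-trans l'≤l l≤x) (<-≤-trans x<h h≤h')

interval-disjoint : ∀ l₁ h₁ l₂ h₂ → h₁ ≤ l₂ →
                    ∀ x → interval l₁ h₁ x ∧ interval l₂ h₂ x ≡ false
interval-disjoint l₁ h₁ l₂ h₂ h₁≤l₂ x with x <? h₁
... | yes x<h₁ rewrite interval-below l₂ h₂ x (<-≤-trans x<h₁ h₁≤l₂) = ∧-comm _ false
... | no  x≮h₁ rewrite interval-above l₁ h₁ x (≮⇒≥ x≮h₁) = refl

intervals-apart : ∀ l₁ h₁ l₂ h₂ → h₁ ≤ l₂ ⊎ h₂ ≤ l₁ →
                  ∀ x → interval l₁ h₁ x ∧ interval l₂ h₂ x ≡ false
intervals-apart l₁ h₁ l₂ h₂ (inj₁ h₁≤l₂) x = interval-disjoint l₁ h₁ l₂ h₂ h₁≤l₂ x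
intervals-apart l₁ h₁ l₂ h₂ (inj₂ h₂≤l₁) x =
  trans (∧-comm (interval l₁ h₁ x) _) (interval-disjoint l₂ h₂ l₁ h₁ h₂≤l₁ x)

count-nowhere : ∀ m → count (λ _ → false) m ≡ 0
count-nowhere zero    = refl
count-nowhere (suc m) = count-nowhere m

count-interval : ∀ m l h → count (interval l h) m ≡ (h ⊓ m) ∸ l
count-interval zero    l       h       = sym (trans (cong (_∸ l) (⊓-zeroʳ h)) (0∸n≡0 l))
count-interval (suc m) zero    zero    = count-nowhere m
count-interval (suc m) zero    (suc h) = cong suc (count-interval m zero h)
count-interval (suc m) (suc l) zero    = count-nowhere m
count-interval (suc m) (suc l) (suc h) = count-interval m l h

count-interval-inside : ∀ m l h → h ≤ m → count (interval l h) m ≡ h ∸ l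
count-interval-inside m l h h≤m = trans (count-interval m l h) (cong (_∸ l) (m≤n⇒m⊓n≡m h≤m))

count-interval-beyond : ∀ m l h → m ≤ h → count (interval l h) m ≡ m ∸ l
count-interval-beyond m l h m≤h = trans (count-interval m l h) (cong (_∸ l) (m≥n⇒m⊓n≡n m≤h))

offset-injective : ∀ {s j j' m m'} .{{_ : NonZero s}} → j < s → j' < s →
                   j + m * s ≡ j' + m' * s → j ≡ j'
offset-injective {s} {j} {j'} {m} {m'} j<s j'<s eq = begin
  j                  ≡⟨ sym (m<n⇒m%n≡m j<s) ⟩
  j % s              ≡⟨ sym ([m+kn]%n≡m%n j m s) ⟩
  (j + m * s) % s    ≡⟨ cong (_% s) eq ⟩
  (j' + m' * s) % s  ≡⟨ [m+kn]%n≡m%n j' m' s ⟩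
  j' % s             ≡⟨ m<n⇒m%n≡m j'<s ⟩
  j'                 ∎
  where open ≡-Reasoning

multiple-above : ∀ s d → 0 < s → ∃ λ m → d ≤ m * s × m * s < d + s
multiple-above s zero    0<s = 0 , z≤n , 0<s
multiple-above s (suc d) 0<s with multiple-above s d 0<s
... | m , d≤ms , ms<d+s with suc d ≤? m * s
...   | yes d<ms = m , d<ms , <-≤-trans ms<d+s (n≤1+n _)
...   | no  d≮ms = suc m , d<ms+s , ms+s<d+1+s
  where
  ms≡d : m * s ≡ d
  ms≡d = ≤-antisym (≤-pred (≰⇒> d≮ms)) d≤ms
  ms+s<d+1+s : s + m * s < suc d + s
  ms+s<d+1+s = subst (_< suc d + s) (trans (+-comm d s) (cong (s +_) (sym ms≡d))) (n<1+n (d + s))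
  d<ms+s : suc d ≤ s + m * s
  d<ms+s = subst (λ x → suc d ≤ s + x) (sym ms≡d) (+-monoˡ-≤ d 0<s)

double : ℕ → ℕ
double x = x + x

double-< : ∀ {a b} → a < b → suc (double a) < double b
double-< {a} {b} a<b = subst (_≤ b + b) (cong suc (+-suc a a)) (+-mono-≤ a<b a<b)

-- k ∸ (k ∸ b) is min(b, k); it exceeds every a below both.
below-both : ∀ {a b k} → a < k → a < b → a < k ∸ (k ∸ b)
below-both {a} {b} {k} a<k a<b with b ≤? k
... | yes b≤k = subst (a <_) (sym (m∸[m∸n]≡n b≤k)) a<b
... | no  b≰k = subst (λ x → a < k ∸ x) (sym (m≤n⇒m∸n≡0 (<⇒≤ (≰⇒> b≰k)))) a<k

module Construction (s₀ e : ℕ) where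

  s k₁ k n : ℕ
  s  = suc s₀
  k₁ = s + e
  k  = suc k₁
  n  = k + s + k

  V : Set
  V = Graph.Vertex (KG n k)

  Adj : V → V → Set
  Adj = Graph.Adj (KG n k)

  vertex : (f : ℕ → Bool) → count f n ≡ k → V
  vertex f size = subsetOf f , trans (∣subsetOf∣ n f) size

  has : V → ℕ → Bool
  has v = member (proj₁ v)

  below : V → ℕ → ℕ
  below v = count (has v)

  has-vertex : ∀ f size x → x < n → has (vertex f size) x ≡ f x
  has-vertex f size = member-subsetOf f

  below-vertex : ∀ f size P → P ≤ n → below (vertex f size) P ≡ count f P
  below-vertex f size P P≤n = count-ext P _ f (λ x x<P → member-subsetOf f x (<-≤-trans x<P P≤n))

  Adj-sym : ∀ u v → Adj u v → Adj v u
  Adj-sym u v = Empty-∩-sym (proj₁ u) (proj₁ v)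

  top : ℕ → ℕ
  top c = k + c + k

  spike : ℕ → ℕ → Bool
  spike c = interval (top c) (suc (top c))

  Iset Jset Hset cover Bset : ℕ → ℕ → Bool
  Iset a         = interval a (a + k)
  Jset a x       = not (interval a (a + k + s) x)
  Hset c x       = interval (suc c) (k + c) x ∨ spike c x
  cover c x      = interval 1 (k + s) x ∨ spike c x
  Bset c x       = not (cover c x)

  top<n : ∀ {c} → c < s → top c < n
  top<n c<s = +-monoˡ-< k (+-monoʳ-< k c<s)

  s<k : s < k
  s<k = s≤s (m≤m+n s e)

  2k≤top : ∀ c → k + k ≤ top c
  2k≤top c = +-monoˡ-≤ k (m≤m+n k c)

  ks<top : ∀ c → k + s < top c
  ks<top c = <-≤-trans (+-monoʳ-< k s<k) (2k≤top c)

  hook-parts-disjoint : ∀ c x → interval (suc c) (k + c) x ∧ spike c x ≡ false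
  hook-parts-disjoint c = interval-disjoint (suc c) (k + c) (top c) (suc (top c)) (m≤m+n (k + c) k)

  spike-size : ∀ {c} → c < s → count (spike c) n ≡ 1
  spike-size {c} c<s = trans (count-interval-inside n (top c) _ (top<n c<s))
                             (trans (+-∸-assoc 1 (≤-refl {top c})) (cong suc (n∸n≡0 (top c))))

  size-I : ∀ a → a ≤ k + s → count (Iset a) n ≡ k
  size-I a a≤ks = trans (count-interval-inside n a (a + k) (+-monoˡ-≤ k a≤ks)) (m+n∸m≡n a k)

  size-J : ∀ a → a ≤ k → count (Jset a) n ≡ k
  size-J a a≤k = trans (count-not n (interval a (a + k + s)) long-size) (m+n∸m≡n (k + s) k)
    where
    fits : a + k + s ≤ n
    fits = subst₂ _≤_ (sym (+-assoc a k s)) (+-comm k (k + s)) (+-monoˡ-≤ (k + s) a≤k)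
    long-size : count (interval a (a + k + s)) n ≡ k + s
    long-size = trans (count-interval-inside n a _ fits)
                      (trans (cong (_∸ a) (+-assoc a k s)) (m+n∸m≡n a (k + s)))

  size-H : ∀ c → c < s → count (Hset c) n ≡ k
  size-H c c<s = begin
    count (Hset c) n
      ≡⟨ count-∨ n (interval (suc c) (k + c)) (spike c) (hook-parts-disjoint c) ⟩
    count (interval (suc c) (k + c)) n + count (spike c) n
      ≡⟨ cong₂ _+_ (count-interval-inside n (suc c) (k + c) k+c≤n) (spike-size c<s) ⟩
    k₁ + c ∸ c + 1
      ≡⟨ cong (_+ 1) (m+n∸n≡m k₁ c) ⟩
    k₁ + 1
      ≡⟨ +-comm k₁ 1 ⟩
    k ∎
    where
    open ≡-Reasoning
    k+c≤n : k + c ≤ n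
    k+c≤n = ≤-trans (m≤m+n (k + c) k) (<⇒≤ (top<n c<s))

  size-B : ∀ c → c < s → count (Bset c) n ≡ k
  size-B c c<s = trans (count-not n (cover c) cover-size) (m+n∸m≡n (k + s) k)
    where
    cover-size : count (cover c) n ≡ k + s
    cover-size = begin
      count (cover c) n
        ≡⟨ count-∨ n (interval 1 (k + s)) (spike c) (interval-disjoint 1 (k + s) (top c) _ (<⇒≤ (ks<top c))) ⟩
      count (interval 1 (k + s)) n + count (spike c) n
        ≡⟨ cong₂ _+_ (count-interval-inside n 1 (k + s) (m≤m+n (k + s) k)) (spike-size c<s) ⟩
      k₁ + s + 1
        ≡⟨ +-comm (k₁ + s) 1 ⟩
      k + s ∎
      where open ≡-Reasoning

  I : (a : ℕ) → a ≤ k + s → V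
  I a a≤ks = vertex (Iset a) (size-I a a≤ks)

  J : (a : ℕ) → a ≤ k → V
  J a a≤k = vertex (Jset a) (size-J a a≤k)

  H : (c : ℕ) → c < s → V
  H c c<s = vertex (Hset c) (size-H c c<s)

  B : (c : ℕ) → c < s → V
  B c c<s = vertex (Bset c) (size-B c c<s)

  -- Only I 0 = [0,k) contains 0 and k-1 but not k+s;
  -- J a contains 0 but neither k-1 nor k+s; B c contains 0 and k+s; H c and I a (a ≥ 1) miss 0 and
  -- are told apart by H c having only k-1 elements below 2k although it contains k-1.
  data Kind : Set where
    kU kI kJ kH kB : Kind

  short : V → Bool
  short v = does (below v (k + k) <? k)

  isHook : V → Bool
  isHook v = has v k₁ ∧ short v

  kind : V → Kind
  kind v = if has v 0
           then (if has v (k + s) then kB else if has v k₁ then kU else kJ)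
           else (if isHook v then kH else kI)

  -- Depth decreases along each thread I, J, I, J, …, I, H, B from B towards its root.
  depthOf : Kind → ℕ → ℕ
  depthOf kU _ = 0
  depthOf kI b = double (k ∸ b)
  depthOf kJ b = suc (double b)
  depthOf kH _ = suc (double k)
  depthOf kB _ = suc (suc (double k))

  depth : V → ℕ
  depth v = depthOf (kind v) (below v k)

  colourOf : Kind → Bool
  colourOf kJ = false
  colourOf kH = false
  colourOf _  = true

  colour : V → Bool
  colour v = colourOf (kind v)

  0<n : 0 < n
  0<n = s≤s z≤n

  k≤n : k ≤ n
  k≤n = ≤-trans (m≤m+n k s) (m≤m+n (k + s) k)

  k₁<n : k₁ < n
  k₁<n = k≤n

  ks<n : k + s < n
  ks<n = m<m+n (k + s) (s≤s z≤n)

  kk≤n : k + k ≤ n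
  kk≤n = +-monoˡ-≤ k (m≤m+n k s)

  kind≡kU : ∀ v → has v 0 ≡ true → has v (k + s) ≡ false → has v k₁ ≡ true → kind v ≡ kU
  kind≡kU v h₀ h₁ h₂ rewrite h₀ | h₁ | h₂ = refl

  kind≡kJ : ∀ v → has v 0 ≡ true → has v (k + s) ≡ false → has v k₁ ≡ false → kind v ≡ kJ
  kind≡kJ v h₀ h₁ h₂ rewrite h₀ | h₁ | h₂ = refl

  kind≡kB : ∀ v → has v 0 ≡ true → has v (k + s) ≡ true → kind v ≡ kB
  kind≡kB v h₀ h₁ rewrite h₀ | h₁ = refl

  kind≡kI : ∀ v → has v 0 ≡ false → isHook v ≡ false → kind v ≡ kI
  kind≡kI v h₀ h₁ rewrite h₀ | h₁ = refl

  kind≡kH : ∀ v → has v 0 ≡ false → isHook v ≡ true → kind v ≡ kH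
  kind≡kH v h₀ h₁ rewrite h₀ | h₁ = refl

  has-I : ∀ a a≤ks x → x < n → has (I a a≤ks) x ≡ Iset a x
  has-I a a≤ks = has-vertex (Iset a) (size-I a a≤ks)

  has-J : ∀ a a≤k x → x < n → has (J a a≤k) x ≡ Jset a x
  has-J a a≤k = has-vertex (Jset a) (size-J a a≤k)

  has-H : ∀ c c<s x → x < n → has (H c c<s) x ≡ Hset c x
  has-H c c<s = has-vertex (Hset c) (size-H c c<s)

  has-B : ∀ c c<s x → x < n → has (B c c<s) x ≡ Bset c x
  has-B c c<s = has-vertex (Bset c) (size-B c c<s)

  kind-U : kind (I 0 z≤n) ≡ kU
  kind-U = kind≡kU (I 0 z≤n) (has-I 0 z≤n 0 0<n)
    (trans (has-I 0 z≤n (k + s) ks<n) (interval-above 0 k (k + s) (m≤m+n k s)))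
    (trans (has-I 0 z≤n k₁ k₁<n) (interval-∋ 0 k k₁ z≤n ≤-refl))

  I-isHook : ∀ a a≤ks → isHook (I a a≤ks) ≡ false
  I-isHook a a≤ks with a ≤? k₁
  ... | yes a≤k₁ = trans (cong (has (I a a≤ks) k₁ ∧_) (dec-false (_ <? k) (<-irrefl full))) (∧-zeroʳ _)
    where
    full : below (I a a≤ks) (k + k) ≡ k
    full = trans (below-vertex (Iset a) (size-I a a≤ks) (k + k) kk≤n)
                 (trans (count-interval-inside (k + k) a (a + k) (+-monoˡ-≤ k (≤-trans a≤k₁ (n≤1+n k₁))))
                        (m+n∸m≡n a k))
  ... | no  a≰k₁ =
    cong (_∧ short (I a a≤ks)) (trans (has-I a a≤ks k₁ k₁<n) (interval-below a (a + k) k₁ (≰⇒> a≰k₁)))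

  kind-I : ∀ a a≤ks → 1 ≤ a → kind (I a a≤ks) ≡ kI
  kind-I a a≤ks 1≤a =
    kind≡kI (I a a≤ks) (trans (has-I a a≤ks 0 0<n) (interval-below a (a + k) 0 1≤a)) (I-isHook a a≤ks)

  kind-J : ∀ a a≤k → 1 ≤ a → a < k → kind (J a a≤k) ≡ kJ
  kind-J a a≤k 1≤a a<k = kind≡kJ (J a a≤k)
    (trans (has-J a a≤k 0 0<n) (cong not (interval-below a (a + k + s) 0 1≤a)))
    (trans (has-J a a≤k (k + s) ks<n) (cong not (interval-∋ a (a + k + s) (k + s) (≤-trans a≤k (m≤m+n k s)) ks<aks)))
    (trans (has-J a a≤k k₁ k₁<n) (cong not (interval-∋ a (a + k + s) k₁ (≤-pred a<k) k≤aks)))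
    where
    ks<aks : k + s < a + k + s
    ks<aks = subst (k + s <_) (sym (+-assoc a k s)) (+-monoˡ-≤ (k + s) 1≤a)
    k≤aks : k ≤ a + k + s
    k≤aks = ≤-trans (m≤n+m k a) (m≤m+n (a + k) s)

  -- H c has only k - 1 elements below 2k (an interval I a containing k - 1 has k of them).
  hook-count : ∀ c → c < s → count (Hset c) (k + k) ≡ k₁
  hook-count c c<s = begin
    count (Hset c) (k + k)
      ≡⟨ count-∨ (k + k) (interval (suc c) (k + c)) (spike c) (hook-parts-disjoint c) ⟩
    count (interval (suc c) (k + c)) (k + k) + count (spike c) (k + k)
      ≡⟨ cong₂ _+_ (count-interval-inside (k + k) (suc c) (k + c) (+-monoʳ-≤ k c≤k))
                   (count-interval-beyond (k + k) (top c) _ (≤-trans (2k≤top c) (n≤1+n _))) ⟩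
    k₁ + c ∸ c + (k + k ∸ top c)
      ≡⟨ cong₂ _+_ (m+n∸n≡m k₁ c) (m≤n⇒m∸n≡0 (2k≤top c)) ⟩
    k₁ + 0
      ≡⟨ +-identityʳ k₁ ⟩
    k₁ ∎
    where
    open ≡-Reasoning
    c≤k : c ≤ k
    c≤k = ≤-trans (<⇒≤ c<s) (<⇒≤ s<k)

  kind-H : ∀ c c<s → kind (H c c<s) ≡ kH
  kind-H c c<s = kind≡kH (H c c<s) (has-H c c<s 0 0<n) (cong₂ _∧_ k₁∈H (dec-true (_ <? k) few))
    where
    k₁∈H : has (H c c<s) k₁ ≡ true
    k₁∈H = trans (has-H c c<s k₁ k₁<n)
             (cong (_∨ spike c k₁) (interval-∋ (suc c) (k + c) k₁ (<-≤-trans c<s (m≤m+n s e)) (m≤m+n k c)))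
    few : below (H c c<s) (k + k) < k
    few = subst (_< k) (sym (trans (below-vertex (Hset c) (size-H c c<s) (k + k) kk≤n) (hook-count c c<s))) ≤-refl

  kind-B : ∀ c c<s → kind (B c c<s) ≡ kB
  kind-B c c<s = kind≡kB (B c c<s) (has-B c c<s 0 0<n)
    (trans (has-B c c<s (k + s) ks<n) (cong not (cong₂ _∨_ (interval-above 1 (k + s) (k + s) ≤-refl)
      (interval-below (top c) (suc (top c)) (k + s) (ks<top c)))))

  below-I : ∀ a a≤ks → below (I a a≤ks) k ≡ k ∸ a
  below-I a a≤ks = trans (below-vertex (Iset a) (size-I a a≤ks) k k≤n) (count-interval-beyond k a (a + k) (m≤n+m k a))

  below-J : ∀ a a≤k → below (J a a≤k) k ≡ a
  below-J a a≤k = begin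
    below (J a a≤k) k                      ≡⟨ below-vertex (Jset a) (size-J a a≤k) k k≤n ⟩
    count (Jset a) k                       ≡⟨ count-not k (interval a (a + k + s)) (count-interval-beyond k a _ k≤aks) ⟩
    k ∸ (k ∸ a)                            ≡⟨ m∸[m∸n]≡n a≤k ⟩
    a                                      ∎
    where
    open ≡-Reasoning
    k≤aks : k ≤ a + k + s
    k≤aks = ≤-trans (m≤n+m k a) (m≤m+n (a + k) s)

  depth-I : ∀ a a≤ks → 1 ≤ a → depth (I a a≤ks) ≡ double (k ∸ (k ∸ a))
  depth-I a a≤ks 1≤a = cong₂ depthOf (kind-I a a≤ks 1≤a) (below-I a a≤ks)

  depth-J : ∀ a a≤k → 1 ≤ a → a < k → depth (J a a≤k) ≡ suc (double a)
  depth-J a a≤k 1≤a a<k = cong₂ depthOf (kind-J a a≤k 1≤a a<k) (below-J a a≤k)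

  depth-H : ∀ c c<s → depth (H c c<s) ≡ suc (double k)
  depth-H c c<s = cong (λ κ → depthOf κ (below (H c c<s) k)) (kind-H c c<s)

  depth-B : ∀ c c<s → depth (B c c<s) ≡ suc (suc (double k))
  depth-B c c<s = cong (λ κ → depthOf κ (below (B c c<s) k)) (kind-B c c<s)

  same-colour : ∀ u v {κ κ'} → kind u ≡ κ → kind v ≡ κ' → colourOf κ ≡ colourOf κ' → colour u ≡ colour v
  same-colour u v refl refl eq = eq

  other-colour : ∀ u v {κ κ'} → kind u ≡ κ → kind v ≡ κ' → colourOf κ ≢ colourOf κ' → colour u ≢ colour v
  other-colour u v refl refl neq = neq

  I-lower : ∀ a b a≤ks b≤ks → I a a≤ks ≡ I b b≤ks → b ≤ a
  I-lower a b a≤ks b≤ks eq = proj₁ (interval-sound b (b + k) a a∈Ib)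
    where
    a<n : a < n
    a<n = ≤-<-trans a≤ks ks<n
    a∈Ib : Iset b a ≡ true
    a∈Ib = begin
      Iset b a            ≡⟨ sym (has-I b b≤ks a a<n) ⟩
      has (I b b≤ks) a    ≡⟨ cong (λ v → has v a) (sym eq) ⟩
      has (I a a≤ks) a    ≡⟨ has-I a a≤ks a a<n ⟩
      Iset a a            ≡⟨ interval-∋ a (a + k) a ≤-refl (m<m+n a (s≤s z≤n)) ⟩
      true                ∎
      where open ≡-Reasoning

  I-injective : ∀ a b a≤ks b≤ks → I a a≤ks ≡ I b b≤ks → a ≡ b
  I-injective a b a≤ks b≤ks eq = ≤-antisym (I-lower b a b≤ks a≤ks (sym eq)) (I-lower a b a≤ks b≤ks eq)

  J-injective : ∀ a b a≤k b≤k → J a a≤k ≡ J b b≤k → a ≡ b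
  J-injective a b a≤k b≤k eq = trans (sym (below-J a a≤k)) (trans (cong (λ v → below v k) eq) (below-J b b≤k))

  spike-hit : ∀ c c' → c' < s → spike c (top c') ≡ true → c ≡ c'
  spike-hit c c' c'<s hit with interval-sound (top c) _ (top c') hit
  ... | top≤ , <top = +-cancelˡ-≡ k c c' (+-cancelʳ-≡ k (k + c) (k + c') (≤-antisym top≤ (≤-pred <top)))

  -- H c contains top c and B c misses it; among the other top c' only the spike can decide this.
  spike-self : ∀ c → spike c (top c) ≡ true
  spike-self c = interval-∋ (top c) (suc (top c)) (top c) ≤-refl ≤-refl

  top∈H : ∀ c c<s → has (H c c<s) (top c) ≡ true
  top∈H c c<s = trans (has-H c c<s (top c) (top<n c<s))
                  (trans (cong (interval (suc c) (k + c) (top c) ∨_) (spike-self c)) (∨-zeroʳ _))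

  top∉B : ∀ c c<s → has (B c c<s) (top c) ≡ false
  top∉B c c<s = trans (has-B c c<s (top c) (top<n c<s))
                  (cong not (trans (cong (_∨ spike c (top c)) (interval-above 1 (k + s) (top c) (<⇒≤ (ks<top c))))
                                   (spike-self c)))

  H-injective : ∀ c c' c<s c'<s → H c c<s ≡ H c' c'<s → c ≡ c'
  H-injective c c' c<s c'<s eq = sym (spike-hit c' c c<s (∨-true-right below-end top∈Hc'))
    where
    top∈Hc' : Hset c' (top c) ≡ true
    top∈Hc' = trans (sym (has-H c' c'<s (top c) (top<n c<s))) (trans (cong (λ v → has v (top c)) (sym eq)) (top∈H c c<s))
    below-end : interval (suc c') (k + c') (top c) ≡ false
    below-end = interval-above (suc c') (k + c') (top c)
                  (≤-trans (+-monoʳ-≤ k (≤-trans (<⇒≤ c'<s) (<⇒≤ s<k))) (2k≤top c))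

  B-injective : ∀ c c' c<s c'<s → B c c<s ≡ B c' c'<s → c ≡ c'
  B-injective c c' c<s c'<s eq = sym (spike-hit c' c c<s (∨-true-right beyond-start top∈cover))
    where
    top∈cover : cover c' (top c) ≡ true
    top∈cover = not-injective (trans (sym (has-B c' c'<s (top c) (top<n c<s)))
                  (trans (cong (λ v → has v (top c)) (sym eq)) (top∉B c c<s)))
    beyond-start : interval 1 (k + s) (top c) ≡ false
    beyond-start = interval-above 1 (k + s) (top c) (<⇒≤ (ks<top c))

  -- The edges used: I b ⊆ [a, a+k+s) misses J a when a ≤ b ≤ a + s; H c and I (k+c) are
  -- interleaved intervals; H c ⊆ cover c and I p ⊆ [1, k+s) ⊆ cover c (1 ≤ p ≤ s) miss B c.
  I-J-adjacent : ∀ a b a≤k b≤ks → a ≤ b → b ≤ a + s → Adj (I b b≤ks) (J a a≤k)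
  I-J-adjacent a b a≤k b≤ks a≤b b≤a+s =
    subsetOf-disjoint (Iset b) (Jset a) (λ x → ⊆-∧-not (interval-⊆ a≤b end≤ x))
    where
    end≤ : b + k ≤ a + k + s
    end≤ = subst (b + k ≤_) (trans (+-assoc a s k) (trans (cong (a +_) (+-comm s k)) (sym (+-assoc a k s))))
                 (+-monoˡ-≤ k b≤a+s)

  I-I-adjacent : ∀ a b a≤ks b≤ks → a + k ≤ b ⊎ b + k ≤ a → Adj (I a a≤ks) (I b b≤ks)
  I-I-adjacent a b _ _ apart = subsetOf-disjoint (Iset a) (Iset b) (intervals-apart a (a + k) b (b + k) apart)

  H-I-adjacent : ∀ c c<s b b≤ks → k + c ≡ b → Adj (H c c<s) (I b b≤ks)
  H-I-adjacent c c<s b _ k+c≡b = subsetOf-disjoint (Hset c) (Iset b) λ x →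
    ∨-∧-false (interval (suc c) (k + c) x) (spike c x)
              (intervals-apart (suc c) (k + c) b (b + k) (inj₁ (≤-reflexive k+c≡b)) x)
              (intervals-apart (top c) (suc (top c)) b (b + k) (inj₂ (≤-reflexive (cong (_+ k) (sym k+c≡b)))) x)

  H-B-adjacent : ∀ c c<s → Adj (H c c<s) (B c c<s)
  H-B-adjacent c c<s = subsetOf-disjoint (Hset c) (Bset c) λ x →
    ⊆-∧-not (∨-⊆ (interval-⊆ (s≤s z≤n) (+-monoʳ-≤ k (<⇒≤ c<s)) x) (λ x∈ → x∈))

  I-B-adjacent : ∀ p p≤ks c c<s → 1 ≤ p → p ≤ s → Adj (I p p≤ks) (B c c<s)
  I-B-adjacent p _ c c<s 1≤p p≤s = subsetOf-disjoint (Iset p) (Bset c) λ x →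
    ⊆-∧-not (λ x∈ → cong (_∨ spike c x) (interval-⊆ 1≤p p+k≤k+s x x∈))
    where
    p+k≤k+s : p + k ≤ k + s
    p+k≤k+s = subst (_≤ k + s) (+-comm k p) (+-monoʳ-≤ k p≤s)

  -- The thread with offset p ≥ 1: I p, J p, I (p+s), J (p+s), …, I b with k ≤ b < k+s, then
  -- H (b-k) and B (b-k).  A member records its kind and its position p + m·s.
  data Member (p : ℕ) (v : V) : Kind → Set where
    onI : ∀ m (lt : p + m * s < k + s) → v ≡ I (p + m * s) (<⇒≤ lt) → Member p v kI
    onJ : ∀ m (lt : p + m * s < k) → v ≡ J (p + m * s) (<⇒≤ lt) → Member p v kJ
    onH : ∀ m c (c<s : c < s) → k + c ≡ p + m * s → v ≡ H c c<s → Member p v kH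
    onB : ∀ m c (c<s : c < s) → k + c ≡ p + m * s → v ≡ B c c<s → Member p v kB

  steps : ∀ {p v κ} → Member p v κ → ℕ
  steps (onI m _ _)     = m
  steps (onJ m _ _)     = m
  steps (onH m _ _ _ _) = m
  steps (onB m _ _ _ _) = m

  member-kind : ∀ {q v κ} → Member (suc q) v κ → kind v ≡ κ
  member-kind (onI m lt refl)        = kind-I _ (<⇒≤ lt) (s≤s z≤n)
  member-kind (onJ m lt refl)        = kind-J _ (<⇒≤ lt) (s≤s z≤n) lt
  member-kind (onH m c c<s _ refl)   = kind-H c c<s
  member-kind (onB m c c<s _ refl)   = kind-B c c<s

  member-position : ∀ {p p' v κ} (x : Member p v κ) (y : Member p' v κ) → p + steps x * s ≡ p' + steps y * s
  member-position (onI _ lt refl) (onI _ lt' eq) = I-injective _ _ (<⇒≤ lt) (<⇒≤ lt') eq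
  member-position (onJ _ lt refl) (onJ _ lt' eq) = J-injective _ _ (<⇒≤ lt) (<⇒≤ lt') eq
  member-position (onH _ c c<s ec refl) (onH _ c' c'<s ec' eq) =
    trans (sym ec) (trans (cong (k +_) (H-injective c c' c<s c'<s eq)) ec')
  member-position (onB _ c c<s ec refl) (onB _ c' c'<s ec' eq) =
    trans (sym ec) (trans (cong (k +_) (B-injective c c' c<s c'<s eq)) ec')

  Tree : Set
  Tree = Fin (suc (suc s))

  thread : Fin s → Tree
  thread j = suc (suc j)

  offset : Fin s → ℕ
  offset j = suc (toℕ j)

  baseV topV : V
  baseV = I 0 z≤n
  topV  = I (k + s) ≤-refl

  kind-top : kind topV ≡ kI
  kind-top = kind-I (k + s) ≤-refl (s≤s z≤n)

  root≤s : ∀ j → offset j + 0 * s ≤ s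
  root≤s j = subst (_≤ s) (sym (+-identityʳ (offset j))) (toℕ<n j)

  root-fits : ∀ j → offset j + 0 * s < k + s
  root-fits j = ≤-trans (s≤s (root≤s j)) (≤-trans s<k (m≤m+n k s))

  threadRoot : Fin s → V
  threadRoot j = I (offset j + 0 * s) (<⇒≤ (root-fits j))

  inTree : Tree → V → Set
  inTree zero          v = v ≡ baseV
  inTree (suc zero)    v = v ≡ topV
  inTree (suc (suc j)) v = ∃ (Member (offset j) v)

  rootOf : Tree → V
  rootOf zero          = baseV
  rootOf (suc zero)    = topV
  rootOf (suc (suc j)) = threadRoot j

  root∈ : ∀ i → inTree i (rootOf i)
  root∈ zero          = refl
  root∈ (suc zero)    = refl
  root∈ (suc (suc j)) = kI , onI 0 (root-fits j) refl

  record Step (P : V → Set) (v : V) : Set where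
    field
      up        : V
      up∈       : P up
      up-adj    : Adj v up
      up-depth  : depth up < depth v
      up-colour : colour up ≢ colour v

  thread-step : ∀ j {v κ} → Member (offset j) v κ → v ≢ threadRoot j → Step (λ u → ∃ (Member (offset j) u)) v
  thread-step j (onI zero lt refl) not-root =
    ⊥-elim (not-root (cong (I (offset j + 0 * s)) (≤-irrelevant (<⇒≤ lt) (<⇒≤ (root-fits j)))))
  thread-step j (onI (suc m) lt refl) _ = record
    { up        = J a (<⇒≤ a<k)
    ; up∈       = kJ , onJ m a<k refl
    ; up-adj    = I-J-adjacent a b (<⇒≤ a<k) (<⇒≤ lt) (subst (a ≤_) (sym b≡a+s) (m≤m+n a s)) (≤-reflexive b≡a+s)
    ; up-depth  = subst₂ _<_ (sym (depth-J a (<⇒≤ a<k) (s≤s z≤n) a<k)) (sym (depth-I b (<⇒≤ lt) (s≤s z≤n)))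
                    (double-< (below-both a<k (subst (a <_) (sym b≡a+s) (m<m+n a (s≤s z≤n)))))
    ; up-colour = other-colour (J a (<⇒≤ a<k)) (I b (<⇒≤ lt))
                    (kind-J a (<⇒≤ a<k) (s≤s z≤n) a<k) (kind-I b (<⇒≤ lt) (s≤s z≤n)) (λ ())
    }
    where
    a b : ℕ
    a = offset j + m * s
    b = offset j + suc m * s
    b≡a+s : b ≡ a + s
    b≡a+s = trans (cong (offset j +_) (+-comm s (m * s))) (sym (+-assoc (offset j) (m * s) s))
    a<k : a < k
    a<k = +-cancelʳ-< s a k (subst (_< k + s) b≡a+s lt)
  thread-step j (onJ m lt refl) _ = record
    { up        = I a (<⇒≤ a<ks)
    ; up∈       = kI , onI m a<ks refl
    ; up-adj    = Adj-sym (I a (<⇒≤ a<ks)) (J a (<⇒≤ lt))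
                    (I-J-adjacent a a (<⇒≤ lt) (<⇒≤ a<ks) ≤-refl (m≤m+n a s))
    ; up-depth  = subst₂ _<_ (sym (trans (depth-I a (<⇒≤ a<ks) (s≤s z≤n)) (cong double (m∸[m∸n]≡n (<⇒≤ lt)))))
                    (sym (depth-J a (<⇒≤ lt) (s≤s z≤n) lt)) ≤-refl
    ; up-colour = other-colour (I a (<⇒≤ a<ks)) (J a (<⇒≤ lt))
                    (kind-I a (<⇒≤ a<ks) (s≤s z≤n)) (kind-J a (<⇒≤ lt) (s≤s z≤n) lt) (λ ())
    }
    where
    a : ℕ
    a = offset j + m * s
    a<ks : a < k + s
    a<ks = <-≤-trans lt (m≤m+n k s)
  thread-step j (onH m c c<s k+c≡b refl) _ = record
    { up        = I b (<⇒≤ b<ks)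
    ; up∈       = kI , onI m b<ks refl
    ; up-adj    = H-I-adjacent c c<s b (<⇒≤ b<ks) k+c≡b
    ; up-depth  = subst₂ _<_ (sym (trans (depth-I b (<⇒≤ b<ks) (s≤s z≤n))
                                         (cong (λ x → double (k ∸ x)) (m≤n⇒m∸n≡0 k≤b))))
                             (sym (depth-H c c<s)) ≤-refl
    ; up-colour = other-colour (I b (<⇒≤ b<ks)) (H c c<s) (kind-I b (<⇒≤ b<ks) (s≤s z≤n)) (kind-H c c<s) (λ ())
    }
    where
    b : ℕ
    b = offset j + m * s
    b<ks : b < k + s
    b<ks = subst (_< k + s) k+c≡b (+-monoʳ-< k c<s)
    k≤b : k ≤ b
    k≤b = subst (k ≤_) k+c≡b (m≤m+n k c)
  thread-step j (onB m c c<s k+c≡b refl) _ = record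
    { up        = H c c<s
    ; up∈       = kH , onH m c c<s k+c≡b refl
    ; up-adj    = Adj-sym (H c c<s) (B c c<s) (H-B-adjacent c c<s)
    ; up-depth  = subst₂ _<_ (sym (depth-H c c<s)) (sym (depth-B c c<s)) ≤-refl
    ; up-colour = other-colour (H c c<s) (B c c<s) (kind-H c c<s) (kind-B c c<s) (λ ())
    }

  step : ∀ i v → inTree i v → v ≢ rootOf i → Step (inTree i) v
  step zero          v v∈ not-root = ⊥-elim (not-root v∈)
  step (suc zero)    v v∈ not-root = ⊥-elim (not-root v∈)
  step (suc (suc j)) v (_ , x) not-root = thread-step j x not-root

  -- The trees are pairwise disjoint: I 0 is the only vertex of its kind, I (k+s) lies beyond every
  -- thread's intervals, and threads are separated by their positions modulo s.
  base≢top : baseV ≢ topV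
  base≢top eq = 0≢1+n (I-injective 0 (k + s) z≤n ≤-refl eq)

  member≢base : ∀ {q v κ} → Member (suc q) v κ → v ≢ baseV
  member≢base x eq =
    no-base-member (subst (Member _ _) (trans (sym (member-kind x)) (trans (cong kind eq) kind-U)) x)
    where
    no-base-member : ∀ {p v} → Member p v kU → ⊥
    no-base-member ()

  member≢top : ∀ {q v κ} → Member (suc q) v κ → v ≢ topV
  member≢top x eq =
    top-interval (subst (Member _ _) (trans (sym (member-kind x)) (trans (cong kind eq) kind-top)) x) eq
    where
    top-interval : ∀ {p v} → Member p v kI → v ≢ topV
    top-interval (onI m lt refl) eq = <-irrefl (I-injective _ (k + s) (<⇒≤ lt) ≤-refl eq) lt

  threads-disjoint : ∀ j j' {v κ κ'} → Member (offset j) v κ → Member (offset j') v κ' → j ≡ j'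
  threads-disjoint j j' x y with trans (sym (member-kind x)) (member-kind y)
  ... | refl = toℕ-injective
                 (offset-injective {m = steps x} {m' = steps y} (toℕ<n j) (toℕ<n j') (suc-injective (member-position x y)))

  disjoint : ∀ {i i' v} → inTree i v → inTree i' v → i ≡ i'
  disjoint {zero}          {zero}           _       _       = refl
  disjoint {zero}          {suc zero}       v≡base  v≡top   = ⊥-elim (base≢top (trans (sym v≡base) v≡top))
  disjoint {zero}          {suc (suc j')}   v≡base  (_ , y) = ⊥-elim (member≢base y v≡base)
  disjoint {suc zero}      {zero}           v≡top   v≡base  = ⊥-elim (base≢top (trans (sym v≡base) v≡top))
  disjoint {suc zero}      {suc zero}       _       _       = refl
  disjoint {suc zero}      {suc (suc j')}   v≡top   (_ , y) = ⊥-elim (member≢top y v≡top)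
  disjoint {suc (suc j)}   {zero}           (_ , x) v≡base  = ⊥-elim (member≢base x v≡base)
  disjoint {suc (suc j)}   {suc zero}       (_ , x) v≡top   = ⊥-elim (member≢top x v≡top)
  disjoint {suc (suc j)}   {suc (suc j')}   (_ , x) (_ , y) = cong thread (threads-disjoint j j' x y)

  thread-end : ∀ j → ∃ λ m → k ≤ offset j + m * s × offset j + m * s < k + s
  thread-end j with multiple-above s (k ∸ offset j) (s≤s z≤n)
  ... | m , lo , hi = m , subst (_≤ p + m * s) (m+[n∸m]≡n p≤k) (+-monoʳ-≤ p lo)
                        , subst (p + m * s <_) p+[k∸p+s]≡k+s (+-monoʳ-< p hi)
    where
    p : ℕ
    p = offset j
    p≤k : p ≤ k
    p≤k = ≤-trans (toℕ<n j) (<⇒≤ s<k)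
    p+[k∸p+s]≡k+s : p + (k ∸ p + s) ≡ k + s
    p+[k∸p+s]≡k+s = trans (sym (+-assoc p (k ∸ p) s)) (cong (_+ s) (m+[n∸m]≡n p≤k))

  OddEdge : Tree → Tree → Set
  OddEdge i i' = ∃ λ u → ∃ λ w → inTree i u × inTree i' w × Adj u w × (colour u ≡ colour w)

  OddEdge-sym : ∀ i i' → OddEdge i i' → OddEdge i' i
  OddEdge-sym _ _ (u , w , u∈ , w∈ , adj , same) = w , u , w∈ , u∈ , Adj-sym u w adj , sym same

  base-top : OddEdge zero (suc zero)
  base-top = baseV , topV , refl , refl , I-I-adjacent 0 (k + s) z≤n ≤-refl (inj₁ (m≤m+n k s))
           , same-colour baseV topV kind-U kind-top refl

  base-thread : ∀ j → OddEdge zero (thread j)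
  base-thread j with thread-end j
  ... | m , k≤b , b<ks = baseV , I b (<⇒≤ b<ks) , refl , (kI , onI m b<ks refl)
                       , I-I-adjacent 0 b z≤n (<⇒≤ b<ks) (inj₁ k≤b)
                       , same-colour baseV (I b (<⇒≤ b<ks)) kind-U (kind-I b (<⇒≤ b<ks) (s≤s z≤n)) refl
    where
    b : ℕ
    b = offset j + m * s

  top-thread : ∀ j → OddEdge (suc zero) (thread j)
  top-thread j = topV , threadRoot j , refl , root∈ (thread j)
               , I-I-adjacent (k + s) p ≤-refl (<⇒≤ (root-fits j))
                   (inj₂ (subst (_≤ k + s) (+-comm k p) (+-monoʳ-≤ k (root≤s j))))
               , same-colour topV (threadRoot j) kind-top (kind-I p (<⇒≤ (root-fits j)) (s≤s z≤n)) refl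
    where
    p : ℕ
    p = offset j + 0 * s

  thread-thread : ∀ j j' → OddEdge (thread j) (thread j')
  thread-thread j j' with thread-end j
  ... | m , k≤b , b<ks = B c c<s , threadRoot j' , (kB , onB m c c<s k+c≡b refl) , root∈ (thread j')
                       , Adj-sym (threadRoot j') (B c c<s)
                           (I-B-adjacent p (<⇒≤ (root-fits j')) c c<s (s≤s z≤n) (root≤s j'))
                       , same-colour (B c c<s) (threadRoot j')
                           (kind-B c c<s) (kind-I p (<⇒≤ (root-fits j')) (s≤s z≤n)) refl
    where
    p c : ℕ
    p = offset j' + 0 * s
    c = offset j + m * s ∸ k
    k+c≡b : k + c ≡ offset j + m * s
    k+c≡b = m+[n∸m]≡n k≤b
    c<s : c < s
    c<s = +-cancelˡ-< k c s (subst (_< k + s) (sym k+c≡b) b<ks)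

  oddEdge : ∀ i i' → i ≢ i' → OddEdge i i'
  oddEdge zero          zero           i≢i = ⊥-elim (i≢i refl)
  oddEdge zero          (suc zero)     _   = base-top
  oddEdge zero          (suc (suc j')) _   = base-thread j'
  oddEdge (suc zero)    zero           _   = OddEdge-sym zero (suc zero) base-top
  oddEdge (suc zero)    (suc zero)     i≢i = ⊥-elim (i≢i refl)
  oddEdge (suc zero)    (suc (suc j')) _   = top-thread j'
  oddEdge (suc (suc j)) zero           _   = OddEdge-sym zero (thread j) (base-thread j)
  oddEdge (suc (suc j)) (suc zero)     _   = OddEdge-sym (suc zero) (thread j) (top-thread j)
  oddEdge (suc (suc j)) (suc (suc j')) _   = thread-thread j j'

  minor : OddMinor (KG n k) (suc (suc s))
  minor = record
    { inT       = inTree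
    ; disjoint  = disjoint
    ; root      = rootOf
    ; root∈     = root∈
    ; parent    = λ i v v∈ nr → Step.up (step i v v∈ nr)
    ; parent∈   = λ i v v∈ nr → Step.up∈ (step i v v∈ nr)
    ; parentAdj = λ i v v∈ nr → Step.up-adj (step i v v∈ nr)
    ; depth     = depth
    ; depthDec  = λ i v v∈ nr → Step.up-depth (step i v v∈ nr)
    ; colour    = colour
    ; proper    = λ i v v∈ nr → Step.up-colour (step i v v∈ nr)
    ; oddEdge   = oddEdge
    }

kneser-shape : ∀ s n k → n ≥ 3 * (2 + s) → n + 2 ≡ (2 + s) + 2 * k →
               ∃ λ e → k ≡ suc (s + e) × n ≡ k + s + k
kneser-shape s n k n≥ eq = k ∸ suc s , sym (m+[n∸m]≡n s<k) , trans n≡s+2k (s+2k≡k+s+k s k)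
  where
  n≡s+2k : n ≡ s + 2 * k
  n≡s+2k = +-cancelʳ-≡ 2 n (s + 2 * k) (trans eq (+-comm 2 (s + 2 * k)))
  3[2+s]≡s+2[3+s] : ∀ s → 3 * (2 + s) ≡ s + 2 * (3 + s)
  3[2+s]≡s+2[3+s] = solve-∀
  s+2k≡k+s+k : ∀ s k → s + 2 * k ≡ k + s + k
  s+2k≡k+s+k = solve-∀
  3+s≤k : 3 + s ≤ k
  3+s≤k = *-cancelˡ-≤ 2 (+-cancelˡ-≤ s _ _ (subst₂ _≤_ (3[2+s]≡s+2[3+s] s) n≡s+2k n≥))
  s<k : s < k
  s<k = ≤-trans (s≤s (m≤n+m s 2)) 3+s≤k

theorem3 : ∀ (t : ℕ) → t ≥ 3 →
    ∃ λ (N : ℕ) → ∀ (n k : ℕ) → n ≥ N → k ≥ 1 → n + 2 ≡ t + 2 * k →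
      OddMinor (KG n k) t
theorem3 zero ()
theorem3 (suc zero) (s≤s ())
theorem3 (suc (suc zero)) (s≤s (s≤s ()))
theorem3 (suc (suc (suc s₀))) _ = 3 * (2 + s) , kneser-minor
  where
  s : ℕ
  s = suc s₀
  kneser-minor : ∀ n k → n ≥ 3 * (2 + s) → k ≥ 1 → n + 2 ≡ (2 + s) + 2 * k → OddMinor (KG n k) (2 + s)
  kneser-minor n k n≥ _ eq with kneser-shape s n k n≥ eq
  ... | e , refl , refl = Construction.minor s₀ e
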